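{- Let $m\ge2$. For every $n\ge1$ and every $q\in\{0,\dots,m-1\}$: (1) $c_m(m(mn+q+1)+1)\equiv 1+(q+1)\,c_m(mn+1)\pmod m$; (2) $\overline{b}_m(m(mn+q))\equiv(2q+1)\,\overline{b}_m(mn)\pmod m$.
   Context: For $m\ge2$ and $n\in\mathbb N_0$, $c_m(n)$ is the number of representations $n=n_0+n_1m+\dots+n_tm^t$ with all $n_i\in\mathbb N_0$ and such that for every $j\ge1$, $n_j>0$ implies $n_{j-1}>0$ ($m$-ary partitions with no gaps). The sequence $(\overline{b}_m(n))_{n\in\mathbb N_0}$ is defined by $\overline{b}_m(0)=1$, $\overline{b}_m(mn)=\overline{b}_m(mn+1)=\dots=\overline{b}_m(mn+m-1)$ for $n\ge0$, and $\overline{b}_m(mn)-\overline{b}_m(mn-1)=\overline{b}_m(n)+\overline{b}_m(n-1)$ for $n\ge1$. -}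

module Defs where

open import Data.Nat using (ℕ; zero; suc; _+_; _*_; _∸_; _^_; _<_; _≤_; _≡ᵇ_; _<ᵇ_)
open import Data.Bool using (Bool; true; false; _∧_; _∨_; not)
open import Data.List using (List; []; _∷_; length; filter; upTo; concatMap; map)
open import Data.Bool using (T)
open import Relation.Nullary.Decidable using (T?)
open import Data.Product using (_×_)
open import Relation.Binary.PropositionalEquality using (_≡_)

-- A candidate representation of n in base m is the coefficient list
-- (n_0, n_1, ..., n_t).  We use coefficient lists of fixed length n+1
-- (indices 0..n); since m^i > n for i ≥ n (m ≥ 2), every coefficient
-- n_i with i > n is necessarily 0, so these lists are in bijection with
-- all finitely supported sequences (n_i) of naturals with Σ n_i m^i = n.

value : ℕ → List ℕ → ℕ
value m []       = 0
value m (x ∷ xs) = x + m * value m xs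

noGapᵇ : List ℕ → Bool
noGapᵇ []             = true
noGapᵇ (x ∷ [])       = true
noGapᵇ (x ∷ y ∷ rest) = (not (0 <ᵇ y) ∨ (0 <ᵇ x)) ∧ noGapᵇ (y ∷ rest)

lists : ℕ → ℕ → List (List ℕ)
lists zero    b = [] ∷ []
lists (suc k) b = concatMap (λ x → map (x ∷_) (lists k b)) (upTo (suc b))

isRepᵇ : ℕ → ℕ → List ℕ → Bool
isRepᵇ m n l = (value m l ≡ᵇ n) ∧ noGapᵇ l

c : ℕ → ℕ → ℕ
c m n = length (filter (λ l → T? (isRepᵇ m n l)) (lists (suc n) n))

IsBbar : ℕ → (ℕ → ℕ) → Set
IsBbar m b =
  (b 0 ≡ 1) × ((∀ n r → suc r < m → b (m * n + suc r) ≡ b (m * n))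
             × (∀ n → b (m * suc n) ≡ b (m * suc n ∸ 1) + b (suc n) + b n))

-- The lowest digit of a gap-free representation of n ≥ 1 is positive, and removing it
-- leaves an arbitrary gap-free representation of some j with m j < n.  Hence
-- c(n) = Σ_{m j < n} c(j), so c is constant, equal to S(K) = Σ_{j ≤ K} c(j), on each block
-- mK + 1, …, mK + m.  Summing, c(m(mn + q + 1) + 1) = S(mn + q + 1) splits into c(0) = 1,
-- the m copies of S(K) coming from each full block below mn + 1, and q + 1 copies of
-- S(n) = c(mn + 1).  Likewise the recursion for b̄ telescopes to b̄(mK) = b̄(K) + 2 Σ_{i<K} b̄(i),
-- and Σ_{i < mn + q} b̄(i) ≡ q b̄(mn) (mod m) because b̄ is constant on blocks of length m.
module Submission where

open import Defs
open import Data.Bool using (Bool; true; false; _∧_; T)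
open import Data.Bool.Properties using (∨-zeroʳ; ∧-zeroʳ; ∧-identityʳ)
open import Data.List using (List; []; _∷_; length; filter; map; concatMap; applyUpTo; _++_)
open import Data.Nat
open import Data.Nat.DivMod using (_%_; [m+kn]%n≡m%n)
open import Data.Nat.Properties
open import Algebra.Properties.CommutativeSemigroup +-commutativeSemigroup using (interchange)
open import Data.Nat.Solver using (module +-*-Solver)
open import Data.Product using (_×_; _,_; proj₁; proj₂)
open import Function using (_∘_)
open import Relation.Binary.PropositionalEquality
open import Relation.Nullary using (¬_; yes; no)
open import Relation.Nullary.Decidable using (T?; dec-true; dec-false)

open +-*-Solver using (solve; _:+_; _:*_; _:=_; con)
open ≡-Reasoning

𝟙 : Bool → ℕ
𝟙 true  = 1
𝟙 false = 0

<ᵇ-true : ∀ {a b} → a < b → (a <ᵇ b) ≡ true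
<ᵇ-true {a} {b} = dec-true (a <? b)

<ᵇ-false : ∀ {a b} → ¬ a < b → (a <ᵇ b) ≡ false
<ᵇ-false {a} {b} = dec-false (a <? b)

≡ᵇ-true⇒≡ : ∀ {a b} → (a ≡ᵇ b) ≡ true → a ≡ b
≡ᵇ-true⇒≡ {a} {b} eq = ≡ᵇ⇒≡ a b (subst T (sym eq) _)

𝟙-<ᵇ-suc : ∀ a n → 𝟙 (a <ᵇ suc n) ≡ 𝟙 (a ≡ᵇ n) + 𝟙 (a <ᵇ n)
𝟙-<ᵇ-suc zero    zero    = refl
𝟙-<ᵇ-suc zero    (suc n) = refl
𝟙-<ᵇ-suc (suc a) zero    = refl
𝟙-<ᵇ-suc (suc a) (suc n) = 𝟙-<ᵇ-suc a n

∑ : ℕ → (ℕ → ℕ) → ℕ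
∑ zero    f = 0
∑ (suc n) f = f 0 + ∑ n (f ∘ suc)

∑-cong : ∀ n {f g : ℕ → ℕ} → (∀ i → i < n → f i ≡ g i) → ∑ n f ≡ ∑ n g
∑-cong zero    eq = refl
∑-cong (suc n) eq = cong₂ _+_ (eq 0 z<s) (∑-cong n (λ i i<n → eq (suc i) (s<s i<n)))

∑-const : ∀ n a → ∑ n (λ _ → a) ≡ n * a
∑-const zero    a = refl
∑-const (suc n) a = cong (a +_) (∑-const n a)

∑-zero : ∀ n {f : ℕ → ℕ} → (∀ i → i < n → f i ≡ 0) → ∑ n f ≡ 0
∑-zero n eq = trans (∑-cong n eq) (trans (∑-const n 0) (*-zeroʳ n))

∑-+ : ∀ a b (f : ℕ → ℕ) → ∑ (a + b) f ≡ ∑ a f + ∑ b (λ i → f (a + i))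
∑-+ zero    b f = refl
∑-+ (suc a) b f = trans (cong (f 0 +_) (∑-+ a b (f ∘ suc))) (sym (+-assoc (f 0) _ _))

∑-snoc : ∀ n (f : ℕ → ℕ) → ∑ (suc n) f ≡ ∑ n f + f n
∑-snoc n f = begin
  ∑ (suc n) f                          ≡⟨ cong (λ k → ∑ k f) (+-comm 1 n) ⟩
  ∑ (n + 1) f                          ≡⟨ ∑-+ n 1 f ⟩
  ∑ n f + (f (n + 0) + 0)              ≡⟨ cong (λ x → ∑ n f + x) (+-identityʳ _) ⟩
  ∑ n f + f (n + 0)                    ≡⟨ cong (λ k → ∑ n f + f k) (+-identityʳ n) ⟩
  ∑ n f + f n                          ∎

∑-distrib : ∀ n (f g : ℕ → ℕ) → ∑ n (λ i → f i + g i) ≡ ∑ n f + ∑ n g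
∑-distrib zero    f g = refl
∑-distrib (suc n) f g =
  trans (cong (f 0 + g 0 +_) (∑-distrib n (f ∘ suc) (g ∘ suc))) (interchange (f 0) (g 0) _ _)

∑-*ˡ : ∀ n a (f : ℕ → ℕ) → ∑ n (λ i → a * f i) ≡ a * ∑ n f
∑-*ˡ zero    a f = sym (*-zeroʳ a)
∑-*ˡ (suc n) a f = trans (cong (a * f 0 +_) (∑-*ˡ n a (f ∘ suc))) (sym (*-distribˡ-+ a (f 0) _))

∑-*ʳ : ∀ n a (f : ℕ → ℕ) → ∑ n (λ i → f i * a) ≡ ∑ n f * a
∑-*ʳ zero    a f = refl
∑-*ʳ (suc n) a f = trans (cong (f 0 * a +_) (∑-*ʳ n a (f ∘ suc))) (sym (*-distribʳ-+ a (f 0) _))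

∑-swap : ∀ a b (h : ℕ → ℕ → ℕ) → ∑ a (λ i → ∑ b (h i)) ≡ ∑ b (λ j → ∑ a (λ i → h i j))
∑-swap zero    b h = sym (∑-zero b (λ _ _ → refl))
∑-swap (suc a) b h = trans (cong (∑ b (h 0) +_) (∑-swap a b (h ∘ suc)))
                           (sym (∑-distrib b (h 0) (λ j → ∑ a (λ i → h (suc i) j))))

∑-block : ∀ m n (f : ℕ → ℕ) → ∑ (m * n) f ≡ ∑ n (λ k → ∑ m (λ r → f (m * k + r)))
∑-block m zero    f = cong (λ k → ∑ k f) (*-zeroʳ m)
∑-block m (suc n) f = begin
  ∑ (m * suc n) f  ≡⟨ cong (λ k → ∑ k f) (trans (*-suc m n) (+-comm m (m * n))) ⟩
  ∑ (m * n + m) f  ≡⟨ ∑-+ (m * n) m f ⟩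
  ∑ (m * n) f + g n ≡⟨ cong (_+ g n) (∑-block m n f) ⟩
  ∑ n g + g n      ≡⟨ sym (∑-snoc n g) ⟩
  ∑ (suc n) g      ∎
  where
  g : ℕ → ℕ
  g k = ∑ m (λ r → f (m * k + r))

∑-*-𝟙-≡ᵇ : ∀ n v (f : ℕ → ℕ) → ∑ n (λ j → f j * 𝟙 (v ≡ᵇ j)) ≡ f v * 𝟙 (v <ᵇ n)
∑-*-𝟙-≡ᵇ zero    v       f = sym (*-zeroʳ (f v))
∑-*-𝟙-≡ᵇ (suc n) zero    f =
  trans (cong (f 0 * 1 +_) (∑-zero n (λ j _ → *-zeroʳ (f (suc j))))) (+-identityʳ _)
∑-*-𝟙-≡ᵇ (suc n) (suc v) f =
  trans (cong (_+ ∑ n (λ j → f (suc j) * 𝟙 (v ≡ᵇ j))) (*-zeroʳ (f 0))) (∑-*-𝟙-≡ᵇ n v (f ∘ suc))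

∑-𝟙-suc+≡ᵇ : ∀ b a n → n ≤ b → ∑ b (λ x → 𝟙 (suc x + a ≡ᵇ n)) ≡ 𝟙 (a <ᵇ n)
∑-𝟙-suc+≡ᵇ b       a zero    _          = ∑-zero b (λ _ _ → refl)
∑-𝟙-suc+≡ᵇ (suc b) a (suc n) (s≤s n≤b) =
  trans (cong (𝟙 (a ≡ᵇ n) +_) (∑-𝟙-suc+≡ᵇ b a n n≤b)) (sym (𝟙-<ᵇ-suc a n))

∑-𝟙-<ᵇ : ∀ t n (f : ℕ → ℕ) → t ≤ n → ∑ n (λ j → 𝟙 (j <ᵇ t) * f j) ≡ ∑ t f
∑-𝟙-<ᵇ zero    n       f _         = ∑-zero n (λ _ _ → refl)
∑-𝟙-<ᵇ (suc t) (suc n) f (s≤s t≤n) = cong₂ _+_ (+-identityʳ (f 0)) (∑-𝟙-<ᵇ t n (f ∘ suc) t≤n)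

module _ {A : Set} where

  count : (A → Bool) → List A → ℕ
  count p []       = 0
  count p (a ∷ as) = 𝟙 (p a) + count p as

  length-filter : ∀ p as → length (filter (T? ∘ p) as) ≡ count p as
  length-filter p []       = refl
  length-filter p (a ∷ as) with p a
  ... | true  = cong suc (length-filter p as)
  ... | false = length-filter p as

  count-cong : ∀ {p q} as → (∀ a → p a ≡ q a) → count p as ≡ count q as
  count-cong []       eq = refl
  count-cong (a ∷ as) eq = cong₂ _+_ (cong 𝟙 (eq a)) (count-cong as eq)

  count-none : ∀ {p} as → (∀ a → p a ≡ false) → count p as ≡ 0
  count-none []       eq = refl
  count-none (a ∷ as) eq = cong₂ _+_ (cong 𝟙 (eq a)) (count-none as eq)

  count-++ : ∀ p as bs → count p (as ++ bs) ≡ count p as + count p bs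
  count-++ p []       bs = refl
  count-++ p (a ∷ as) bs =
    trans (cong (𝟙 (p a) +_) (count-++ p as bs)) (sym (+-assoc (𝟙 (p a)) _ _))

  count-concatMap-applyUpTo : ∀ p (f : ℕ → List A) (h : ℕ → ℕ) n →
    count p (concatMap f (applyUpTo h n)) ≡ ∑ n (λ i → count p (f (h i)))
  count-concatMap-applyUpTo p f h zero    = refl
  count-concatMap-applyUpTo p f h (suc n) =
    trans (count-++ p (f (h 0)) _)
          (cong (count p (f (h 0)) +_) (count-concatMap-applyUpTo p f (h ∘ suc) n))

  count-fibres : (v : A → ℕ) (P : ℕ → Bool) (q : A → Bool) (t : ℕ) →
    (∀ j → P j ≡ true → j < t) → ∀ as →
    count (λ a → P (v a) ∧ q a) as ≡ ∑ t (λ j → 𝟙 (P j) * count (λ a → (v a ≡ᵇ j) ∧ q a) as)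
  count-fibres v P q t bound []       = sym (∑-zero t (λ j _ → *-zeroʳ (𝟙 (P j))))
  count-fibres v P q t bound (a ∷ as) = begin
    𝟙 (P (v a) ∧ q a) + count _ as
      ≡⟨ cong₂ _+_ head (count-fibres v P q t bound as) ⟩
    ∑ t (λ j → 𝟙 (P j) * 𝟙 (here j)) + ∑ t (λ j → 𝟙 (P j) * count (there j) as)
      ≡⟨ sym (∑-distrib t _ _) ⟩
    ∑ t (λ j → 𝟙 (P j) * 𝟙 (here j) + 𝟙 (P j) * count (there j) as)
      ≡⟨ ∑-cong t (λ j _ → sym (*-distribˡ-+ (𝟙 (P j)) _ _)) ⟩
    ∑ t (λ j → 𝟙 (P j) * count (there j) (a ∷ as)) ∎
    where
    there : ℕ → A → Bool
    there j a = (v a ≡ᵇ j) ∧ q a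

    here : ℕ → Bool
    here j = there j a

    𝟙-fibre : ∀ w → 𝟙 (P w) ≡ ∑ t (λ j → 𝟙 (P j) * 𝟙 (w ≡ᵇ j))
    𝟙-fibre w = sym (trans (∑-*-𝟙-≡ᵇ t w (𝟙 ∘ P)) in-range)
      where
      in-range : 𝟙 (P w) * 𝟙 (w <ᵇ t) ≡ 𝟙 (P w)
      in-range with P w in eq
      ... | false = refl
      ... | true  = cong (λ x → 1 * 𝟙 x) (<ᵇ-true (bound w eq))

    head : 𝟙 (P (v a) ∧ q a) ≡ ∑ t (λ j → 𝟙 (P j) * 𝟙 (here j))
    head with q a
    ... | true  = trans (cong 𝟙 (∧-identityʳ _)) (trans (𝟙-fibre (v a))
                    (∑-cong t (λ j _ → cong (λ x → 𝟙 (P j) * 𝟙 x) (sym (∧-identityʳ _)))))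
    ... | false = trans (cong 𝟙 (∧-zeroʳ _)) (sym (∑-zero t (λ j _ →
                    trans (cong (λ x → 𝟙 (P j) * 𝟙 x) (∧-zeroʳ _)) (*-zeroʳ (𝟙 (P j))))))

count-lists-suc : ∀ p k b →
  count p (lists (suc k) b) ≡ ∑ (suc b) (λ x → count (p ∘ (x ∷_)) (lists k b))
count-lists-suc p k b =
  trans (count-concatMap-applyUpTo p (λ x → map (x ∷_) (lists k b)) (λ x → x) (suc b))
        (∑-cong (suc b) (λ x _ → count-map x (lists k b)))
  where
  count-map : ∀ x ls → count p (map (x ∷_) ls) ≡ count (p ∘ (x ∷_)) ls
  count-map x []       = refl
  count-map x (l ∷ ls) = cong (𝟙 (p (x ∷ l)) +_) (count-map x ls)

noGap-suc∷ : ∀ x l → noGapᵇ (suc x ∷ l) ≡ noGapᵇ l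
noGap-suc∷ x []      = refl
noGap-suc∷ x (y ∷ l) = cong (_∧ noGapᵇ (y ∷ l)) (∨-zeroʳ _)

noGap-tail : ∀ x l → noGapᵇ (x ∷ l) ≡ true → noGapᵇ l ≡ true
noGap-tail x []      _  = refl
noGap-tail x (y ∷ l) ok with noGapᵇ (y ∷ l)
... | true = refl
... | false = trans (sym (∧-zeroʳ _)) ok

module _ (m : ℕ) .{{_ : NonZero m}} where

  noGap-0∷⇒value≡0 : ∀ l → noGapᵇ (0 ∷ l) ≡ true → value m l ≡ 0
  noGap-0∷⇒value≡0 []          _  = refl
  noGap-0∷⇒value≡0 (zero ∷ l)  ok = trans (cong (m *_) (noGap-0∷⇒value≡0 l ok)) (*-zeroʳ m)
  noGap-0∷⇒value≡0 (suc x ∷ l) ()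

  value≡0⇒noGap-0∷ : ∀ l → value m l ≡ 0 → noGapᵇ (0 ∷ l) ≡ true
  value≡0⇒noGap-0∷ []          _  = refl
  value≡0⇒noGap-0∷ (zero ∷ l)  eq =
    value≡0⇒noGap-0∷ l (m*n≡0⇒m≡0 (value m l) m (trans (*-comm _ m) eq))
  value≡0⇒noGap-0∷ (suc x ∷ l) ()

  reps : ℕ → ℕ → ℕ → ℕ
  reps k b n = count (isRepᵇ m n) (lists k b)

  c≡reps : ∀ n → c m n ≡ reps (suc n) n n
  c≡reps n = length-filter (isRepᵇ m n) (lists (suc n) n)

  reps-zero : ∀ k b → reps k b 0 ≡ 1
  reps-zero zero    b = refl
  reps-zero (suc k) b = begin
    reps (suc k) b 0
      ≡⟨ count-lists-suc (isRepᵇ m 0) k b ⟩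
    count (isRepᵇ m 0 ∘ (0 ∷_)) L + ∑ b (λ x → count (isRepᵇ m 0 ∘ (suc x ∷_)) L)
      ≡⟨ cong₂ _+_ (count-cong L leading-zero) (∑-zero b (λ _ _ → count-none L (λ _ → refl))) ⟩
    reps k b 0 + 0
      ≡⟨ +-identityʳ _ ⟩
    reps k b 0
      ≡⟨ reps-zero k b ⟩
    1 ∎
    where
    L : List (List ℕ)
    L = lists k b

    leading-zero : ∀ l → isRepᵇ m 0 (0 ∷ l) ≡ isRepᵇ m 0 l
    leading-zero l with value m l in eq
    ... | zero  rewrite *-zeroʳ m =
      trans (value≡0⇒noGap-0∷ l eq) (sym (noGap-tail 0 l (value≡0⇒noGap-0∷ l eq)))
    ... | suc v = cong (_∧ noGapᵇ (0 ∷ l))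
                        (dec-false (m * suc v ≟ 0) (≢-nonZero⁻¹ _ {{m*n≢0 m (suc v)}}))

  reps-suc : ∀ k b n → 1 ≤ n → n ≤ b →
    reps (suc k) b n ≡ ∑ n (λ j → 𝟙 (m * j <ᵇ n) * reps k b j)
  reps-suc k b n@(suc _) _ n≤b = begin
    reps (suc k) b n
      ≡⟨ count-lists-suc (isRepᵇ m n) k b ⟩
    count (isRepᵇ m n ∘ (0 ∷_)) L + ∑ b lowest-digit-suc
      ≡⟨ cong (_+ ∑ b lowest-digit-suc) (count-none L positive-lowest-digit) ⟩
    ∑ b lowest-digit-suc
      ≡⟨ ∑-cong b (λ x _ → split-by-tail x) ⟩
    ∑ b (λ x → ∑ n (λ j → 𝟙 (suc x + m * j ≡ᵇ n) * reps k b j))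
      ≡⟨ ∑-swap b n (λ x j → 𝟙 (suc x + m * j ≡ᵇ n) * reps k b j) ⟩
    ∑ n (λ j → ∑ b (λ x → 𝟙 (suc x + m * j ≡ᵇ n) * reps k b j))
      ≡⟨ ∑-cong n (λ j _ → trans (∑-*ʳ b (reps k b j) _)
                                 (cong (_* reps k b j) (∑-𝟙-suc+≡ᵇ b (m * j) n n≤b))) ⟩
    ∑ n (λ j → 𝟙 (m * j <ᵇ n) * reps k b j) ∎
    where
    L : List (List ℕ)
    L = lists k b

    lowest-digit-suc : ℕ → ℕ
    lowest-digit-suc x = count (isRepᵇ m n ∘ (suc x ∷_)) L

    positive-lowest-digit : ∀ l → isRepᵇ m n (0 ∷ l) ≡ false
    positive-lowest-digit l with noGapᵇ (0 ∷ l) in ok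
    ... | false = ∧-zeroʳ _
    ... | true  rewrite noGap-0∷⇒value≡0 l ok | *-zeroʳ m = refl

    split-by-tail : ∀ x → lowest-digit-suc x ≡ ∑ n (λ j → 𝟙 (suc x + m * j ≡ᵇ n) * reps k b j)
    split-by-tail x =
      trans (count-cong L (λ l → cong ((suc x + m * value m l ≡ᵇ n) ∧_) (noGap-suc∷ x l)))
            (count-fibres (value m) (λ j → suc x + m * j ≡ᵇ n) noGapᵇ n tail-below L)
      where
      tail-below : ∀ j → (suc x + m * j ≡ᵇ n) ≡ true → j < n
      tail-below j eq =
        subst (j <_) (≡ᵇ-true⇒≡ eq) (s≤s (≤-trans (m≤n*m j m) (m≤n+m (m * j) x)))

  -- A gap-free representation of n has at most n nonzero digits, all ≤ n.
  reps-stable : ∀ k k′ b b′ n → n ≤ k → n ≤ k′ → n ≤ b → n ≤ b′ → reps k b n ≡ reps k′ b′ n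
  reps-stable k       k′       b b′ zero      _ _ _ _ =
    trans (reps-zero k b) (sym (reps-zero k′ b′))
  reps-stable zero    k′       b b′ (suc _) () _ _ _
  reps-stable (suc k) zero     b b′ (suc _) _ () _ _
  reps-stable (suc k) (suc k′) b b′ n@(suc _) n≤1+k n≤1+k′ n≤b n≤b′ = begin
    reps (suc k) b n
      ≡⟨ reps-suc k b n (s≤s z≤n) n≤b ⟩
    ∑ n (λ j → 𝟙 (m * j <ᵇ n) * reps k b j)
      ≡⟨ ∑-cong n (λ j j<n → cong (𝟙 (m * j <ᵇ n) *_) (IH j j<n)) ⟩
    ∑ n (λ j → 𝟙 (m * j <ᵇ n) * reps k′ b′ j)
      ≡⟨ sym (reps-suc k′ b′ n (s≤s z≤n) n≤b′) ⟩
    reps (suc k′) b′ n ∎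
    where
    IH : ∀ j → j < n → reps k b j ≡ reps k′ b′ j
    IH j j<n = reps-stable k k′ b b′ j (≤-pred (≤-trans j<n n≤1+k)) (≤-pred (≤-trans j<n n≤1+k′))
                 (<⇒≤ (<-≤-trans j<n n≤b)) (<⇒≤ (<-≤-trans j<n n≤b′))

  c-zero : c m 0 ≡ 1
  c-zero = trans (c≡reps 0) (reps-zero 1 0)

  c-rec : ∀ n → 1 ≤ n → c m n ≡ ∑ n (λ j → 𝟙 (m * j <ᵇ n) * c m j)
  c-rec n 1≤n = begin
    c m n
      ≡⟨ c≡reps n ⟩
    reps (suc n) n n
      ≡⟨ reps-suc n n n 1≤n ≤-refl ⟩
    ∑ n (λ j → 𝟙 (m * j <ᵇ n) * reps n n j)
      ≡⟨ ∑-cong n (λ j j<n → cong (𝟙 (m * j <ᵇ n) *_) (reps≡c j j<n)) ⟩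
    ∑ n (λ j → 𝟙 (m * j <ᵇ n) * c m j) ∎
    where
    reps≡c : ∀ j → j < n → reps n n j ≡ c m j
    reps≡c j j<n = trans (reps-stable n (suc j) n j j (<⇒≤ j<n) (n≤1+n j) (<⇒≤ j<n) ≤-refl)
                         (sym (c≡reps j))

  m*j<ᵇm*k+r : ∀ k r j → 1 ≤ r → r ≤ m → (m * j <ᵇ m * k + r) ≡ (j <ᵇ suc k)
  m*j<ᵇm*k+r k r j 1≤r r≤m with j ≤? k
  ... | yes j≤k = trans (<ᵇ-true (≤-<-trans (*-monoʳ-≤ m j≤k) (m<m+n (m * k) 1≤r)))
                        (sym (<ᵇ-true (s≤s j≤k)))
  ... | no  j≰k = trans (<ᵇ-false (≤⇒≯ m*k+r≤m*j)) (sym (<ᵇ-false (j≰k ∘ ≤-pred)))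
    where
    m*k+r≤m*j : m * k + r ≤ m * j
    m*k+r≤m*j = ≤-trans (+-monoʳ-≤ (m * k) r≤m)
                  (≤-trans (≤-reflexive (trans (+-comm (m * k) m) (sym (*-suc m k))))
                           (*-monoʳ-≤ m (≰⇒> j≰k)))

  c-block : ∀ k r → 1 ≤ r → r ≤ m → c m (m * k + r) ≡ ∑ (suc k) (c m)
  c-block k r 1≤r r≤m = begin
    c m N
      ≡⟨ c-rec N (≤-trans 1≤r (m≤n+m r (m * k))) ⟩
    ∑ N (λ j → 𝟙 (m * j <ᵇ N) * c m j)
      ≡⟨ ∑-cong N (λ j _ → cong (λ t → 𝟙 t * c m j) (m*j<ᵇm*k+r k r j 1≤r r≤m)) ⟩
    ∑ N (λ j → 𝟙 (j <ᵇ suc k) * c m j)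
      ≡⟨ ∑-𝟙-<ᵇ (suc k) N (c m) 1+k≤N ⟩
    ∑ (suc k) (c m) ∎
    where
    N : ℕ
    N = m * k + r

    1+k≤N : suc k ≤ N
    1+k≤N = subst (_≤ N) (+-comm k 1) (+-mono-≤ (m≤n*m k m) 1≤r)

  ∑-c-suc-blocks : ∀ n → ∑ (m * n) (c m ∘ suc) ≡ m * ∑ n (λ k → ∑ (suc k) (c m))
  ∑-c-suc-blocks n = begin
    ∑ (m * n) (c m ∘ suc)                         ≡⟨ ∑-block m n (c m ∘ suc) ⟩
    ∑ n (λ k → ∑ m (λ r → c m (suc (m * k + r)))) ≡⟨ ∑-cong n (λ k _ → ∑-cong m (block k)) ⟩
    ∑ n (λ k → ∑ m (λ _ → ∑ (suc k) (c m)))       ≡⟨ ∑-cong n (λ k _ → ∑-const m _) ⟩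
    ∑ n (λ k → m * ∑ (suc k) (c m))               ≡⟨ ∑-*ˡ n m _ ⟩
    m * ∑ n (λ k → ∑ (suc k) (c m))               ∎
    where
    block : ∀ k r → r < m → c m (suc (m * k + r)) ≡ ∑ (suc k) (c m)
    block k r r<m = trans (cong (c m) (sym (+-suc (m * k) r))) (c-block k (suc r) (s≤s z≤n) r<m)

  c-congruence : ∀ n q → q < m →
    c m (m * (m * n + q + 1) + 1) % m ≡ (1 + (q + 1) * c m (m * n + 1)) % m
  c-congruence n q q<m = trans (cong (_% m) expansion) ([m+kn]%n≡m%n _ Y m)
    where
    1≤m : 1 ≤ m
    1≤m = >-nonZero⁻¹ m

    Y : ℕ
    Y = ∑ n (λ k → ∑ (suc k) (c m))

    S : ℕ
    S = ∑ (suc n) (c m)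

    last-blocks : ∑ (suc q) (λ i → c m (suc (m * n) + i)) ≡ suc q * S
    last-blocks = trans (∑-cong (suc q) block) (∑-const (suc q) S)
      where
      block : ∀ i → i < suc q → c m (suc (m * n) + i) ≡ S
      block i i≤q = trans (cong (c m) (sym (+-suc (m * n) i)))
                          (c-block n (suc i) (s≤s z≤n) (≤-trans i≤q q<m))

    expansion : c m (m * (m * n + q + 1) + 1) ≡ (1 + (q + 1) * c m (m * n + 1)) + Y * m
    expansion = begin
      c m (m * (m * n + q + 1) + 1)
        ≡⟨ c-block (m * n + q + 1) 1 ≤-refl 1≤m ⟩
      ∑ (suc (m * n + q + 1)) (c m)
        ≡⟨ cong (λ t → ∑ (suc t) (c m)) (trans (+-assoc (m * n) q 1) (cong (m * n +_) (+-comm q 1)))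
         ⟩
      ∑ (suc (m * n) + suc q) (c m)
        ≡⟨ ∑-+ (suc (m * n)) (suc q) (c m) ⟩
      ∑ (suc (m * n)) (c m) + ∑ (suc q) (λ i → c m (suc (m * n) + i))
        ≡⟨ cong₂ _+_ (cong₂ _+_ c-zero (∑-c-suc-blocks n)) last-blocks ⟩
      1 + m * Y + suc q * S
        ≡⟨ solve 4 (λ y s q m → con 1 :+ m :* y :+ (con 1 :+ q) :* s
                              := con 1 :+ (q :+ con 1) :* s :+ y :* m) refl Y S q m ⟩
      1 + (q + 1) * S + Y * m
        ≡⟨ cong (λ x → 1 + (q + 1) * x + Y * m) (sym (c-block n 1 ≤-refl 1≤m)) ⟩
      1 + (q + 1) * c m (m * n + 1) + Y * m ∎

module _ (m : ℕ) .{{_ : NonZero m}} (b : ℕ → ℕ) (isBbar : IsBbar m b) where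

  b-block : ∀ k r → r < m → b (m * k + r) ≡ b (m * k)
  b-block k zero    _ = cong b (+-identityʳ (m * k))
  b-block k (suc r)   = proj₁ (proj₂ isBbar) k r

  b-last-of-block : ∀ k → b (m * suc k ∸ 1) ≡ b (m * k)
  b-last-of-block k = trans (cong b m*[1+k]∸1) (b-block k (m ∸ 1) (m≤pred[n]⇒suc[m]≤n ≤-refl))
    where
    m*[1+k]∸1 : m * suc k ∸ 1 ≡ m * k + (m ∸ 1)
    m*[1+k]∸1 = trans (cong (_∸ 1) (*-suc m k))
                      (trans (+-∸-comm (m * k) (>-nonZero⁻¹ m)) (+-comm (m ∸ 1) (m * k)))

  b-multiple : ∀ k → b (m * k) ≡ b k + 2 * ∑ k b
  b-multiple zero    = trans (cong b (*-zeroʳ m)) (sym (+-identityʳ (b 0)))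
  b-multiple (suc k) = begin
    b (m * suc k)
      ≡⟨ proj₂ (proj₂ isBbar) k ⟩
    b (m * suc k ∸ 1) + b (suc k) + b k
      ≡⟨ cong (λ x → x + b (suc k) + b k) (trans (b-last-of-block k) (b-multiple k)) ⟩
    b k + 2 * ∑ k b + b (suc k) + b k
      ≡⟨ solve 3 (λ x s y → x :+ con 2 :* s :+ y :+ x := y :+ con 2 :* (s :+ x))
               refl (b k) (∑ k b) (b (suc k)) ⟩
    b (suc k) + 2 * (∑ k b + b k)
      ≡⟨ cong (λ s → b (suc k) + 2 * s) (sym (∑-snoc k b)) ⟩
    b (suc k) + 2 * ∑ (suc k) b ∎

  ∑-b-blocks : ∀ n → ∑ (m * n) b ≡ m * ∑ n (λ k → b (m * k))
  ∑-b-blocks n = begin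
    ∑ (m * n) b                           ≡⟨ ∑-block m n b ⟩
    ∑ n (λ k → ∑ m (λ r → b (m * k + r))) ≡⟨ ∑-cong n (λ k _ → ∑-cong m (b-block k)) ⟩
    ∑ n (λ k → ∑ m (λ _ → b (m * k)))     ≡⟨ ∑-cong n (λ k _ → ∑-const m _) ⟩
    ∑ n (λ k → m * b (m * k))             ≡⟨ ∑-*ˡ n m _ ⟩
    m * ∑ n (λ k → b (m * k))             ∎

  b-congruence : ∀ n q → q < m → b (m * (m * n + q)) % m ≡ ((2 * q + 1) * b (m * n)) % m
  b-congruence n q q<m = trans (cong (_% m) expansion) ([m+kn]%n≡m%n _ (2 * Y) m)
    where
    Y : ℕ
    Y = ∑ n (λ k → b (m * k))

    ∑-below : ∑ (m * n + q) b ≡ m * Y + q * b (m * n)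
    ∑-below = begin
      ∑ (m * n + q) b
        ≡⟨ ∑-+ (m * n) q b ⟩
      ∑ (m * n) b + ∑ q (λ i → b (m * n + i))
        ≡⟨ cong (∑ (m * n) b +_) (∑-cong q (λ i i<q → b-block n i (<-trans i<q q<m))) ⟩
      ∑ (m * n) b + ∑ q (λ _ → b (m * n))
        ≡⟨ cong₂ _+_ (∑-b-blocks n) (∑-const q _) ⟩
      m * Y + q * b (m * n) ∎

    expansion : b (m * (m * n + q)) ≡ (2 * q + 1) * b (m * n) + 2 * Y * m
    expansion = begin
      b (m * (m * n + q))
        ≡⟨ b-multiple (m * n + q) ⟩
      b (m * n + q) + 2 * ∑ (m * n + q) b
        ≡⟨ cong₂ (λ x s → x + 2 * s) (b-block n q q<m) ∑-below ⟩
      b (m * n) + 2 * (m * Y + q * b (m * n))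
        ≡⟨ solve 4 (λ x y q m → x :+ con 2 :* (m :* y :+ q :* x)
                              := (con 2 :* q :+ con 1) :* x :+ con 2 :* y :* m)
                   refl (b (m * n)) Y q m ⟩
      (2 * q + 1) * b (m * n) + 2 * Y * m ∎

theorem11 : (m : ℕ) .{{_ : NonZero m}} → 2 ≤ m → (b : ℕ → ℕ) → IsBbar m b →
    (n q : ℕ) → 1 ≤ n → q < m →
      (c m (m * (m * n + q + 1) + 1) % m ≡ (1 + (q + 1) * c m (m * n + 1)) % m)
      × (b (m * (m * n + q)) % m ≡ ((2 * q + 1) * b (m * n)) % m)
theorem11 m _ b isBbar n q _ q<m = c-congruence m n q q<m , b-congruence m b isBbar n q q<m
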